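{- Fix positive integers $\alpha,\beta$ with $2\beta+2\ge\alpha\ge\beta+3$. For every $m\in\mathbb{N}_{\ge2}$ and every graph $X$ with $\text{ffn}(X)=m-1$, we have $\text{ffn}(G(m,X))=m$.
   Context: All graphs are finite, simple and undirected. For a graph $G=(V,E)$ and $W\subseteq V$, $N(W)$ is the set of nodes in $V\setminus W$ adjacent to at least one node of $W$. For $m\in\mathbb{N}_{>0}$, an $m$-strategy of length $T$ is a sequence $(F_1,\dots,F_T)$ of subsets of $V$ with $|F_i|\le m$. Its burning sets are $B_0=V$ and $B_t=(B_{t-1}\setminus F_t)\cup N(B_{t-1}\setminus F_t)$ for $t\ge1$, where $F_t=\emptyset$ for $t>T$. The strategy is winning if $B_T=\emptyset$. $\text{ffn}(G)$ is the smallest $m$ admitting a winning $m$-strategy. Auxiliary graph $H_m$ ($m\ge2$): nodes $v_1,\dots,v_{m-1},w_1,\dots,w_\alpha$; the $v_i$ form a clique, every $v_i$ is adjacent to every $w_j$; no other edges. Graph $G(m,X)$: add to $X$ a new node $c$ adjacent to every node of $X$; add $m$ disjoint paths $(v^i_1,\dots,v^i_\beta)$, $i\in[m]$, with $c$ adjacent to each $v^i_1$; add $m$ disjoint copies $H^1_m,\dots,H^m_m$ of $H_m$, and for each $i\in[m]$ connect $v^i_\beta$ to one arbitrary node $u_i$ of the $(m-1)$-clique of $H^i_m$. -}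

module Defs where

open import Level using (Level; 0ℓ) renaming (suc to lsuc)
open import Data.Nat using (ℕ; zero; suc; _≤_; _<_; _∸_)
open import Data.Nat.Properties using (n<1+n; <-irrefl)
open import Data.Fin using (Fin; toℕ)
open import Data.List using (List; length; foldl)
open import Data.List.Membership.Propositional using (_∉_)
open import Data.List.Relation.Unary.All using (All)
open import Data.Product using (Σ; _×_; _,_)
open import Data.Sum using (_⊎_; inj₁; inj₂)
open import Data.Unit using (⊤)
open import Data.Empty using (⊥)
open import Relation.Nullary using (¬_)
open import Relation.Binary.PropositionalEquality using (_≡_; _≢_; refl) renaming (sym to sym≡)
open import Function.Bundles using (_↔_)

record Graph : Set₁ where
  field
    V      : Set
    Adj    : V → V → Set
    sym    : ∀ {x y} → Adj x y → Adj y x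
    irrefl : ∀ {x} → ¬ Adj x x
open Graph public

Finite : Graph → Set
Finite G = Σ ℕ λ n → V G ↔ Fin n

-- A set F of at most m nodes is represented by a list of nodes of length ≤ m
-- (duplicates allowed; this represents exactly the sets of size ≤ m).

-- One burning step: B_t = (B_{t-1} \ F_t) ∪ N(B_{t-1} \ F_t).
-- (Since W ∪ N(W) = W ∪ {v | v adjacent to some node of W}.)
step : (G : Graph) → (V G → Set) → List (V G) → (V G → Set)
step G B F v = (B v × v ∉ F) ⊎ Σ (V G) (λ u → Adj G u v × B u × u ∉ F)

burning : (G : Graph) → List (List (V G)) → V G → Set
burning G S = foldl (step G) (λ _ → ⊤) S

WinningStrategy : (G : Graph) → ℕ → List (List (V G)) → Set
WinningStrategy G m S =
  All (λ F → length F ≤ m) S × (∀ v → ¬ burning G S v)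

Winnable : Graph → ℕ → Set
Winnable G m = Σ (List (List (V G))) (WinningStrategy G m)

IsFFN : Graph → ℕ → Set
IsFFN G m = 0 < m × Winnable G m × (∀ k → 0 < k → Winnable G k → m ≤ k)

-- The graph G(m, X)
-- Paths v^i_1..v^i_β are  path i j  with toℕ j + 1 = index.
-- Copy H^i_m: clique nodes  hv i a  (a : Fin (m ∸ 1)), other nodes  hw i b  (b : Fin α).
-- u : Fin m → Fin (m ∸ 1) chooses the clique node u_i of H^i_m attached to v^i_β.

data GV (α β m : ℕ) (X : Set) : Set where
  old  : X → GV α β m X
  c    : GV α β m X
  path : Fin m → Fin β → GV α β m X
  hv   : Fin m → Fin (m ∸ 1) → GV α β m X
  hw   : Fin m → Fin α → GV α β m X

module _ (α β m : ℕ) (X : Graph) (u : Fin m → Fin (m ∸ 1)) where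

  -- one orientation of each edge
  data E : GV α β m (V X) → GV α β m (V X) → Set where
    e-X      : ∀ {a b} → Adj X a b → E (old a) (old b)
    e-cX     : ∀ {a} → E c (old a)
    e-cpath  : ∀ {i j} → toℕ j ≡ 0 → E c (path i j)
    e-path   : ∀ {i j j'} → toℕ j' ≡ suc (toℕ j) → E (path i j) (path i j')
    e-pathH  : ∀ {i j} → suc (toℕ j) ≡ β → E (path i j) (hv i (u i))
    e-clique : ∀ {i a b} → a ≢ b → E (hv i a) (hv i b)
    e-H      : ∀ {i a b} → E (hv i a) (hw i b)

  GAdj : GV α β m (V X) → GV α β m (V X) → Set
  GAdj x y = E x y ⊎ E y x

  private
    E-irrefl : ∀ {x} → ¬ E x x
    E-irrefl (e-X p) = irrefl X p
    E-irrefl (e-path {j = j} p) = <-irrefl p (n<1+n (toℕ j))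
    E-irrefl (e-clique p) = p refl

    GAdj-irrefl : ∀ {x} → ¬ GAdj x x
    GAdj-irrefl (inj₁ e) = E-irrefl e
    GAdj-irrefl (inj₂ e) = E-irrefl e

    GAdj-sym : ∀ {x y} → GAdj x y → GAdj y x
    GAdj-sym (inj₁ e) = inj₂ e
    GAdj-sym (inj₂ e) = inj₁ e

  Gm : Graph
  Gm = record
    { V = GV α β m (V X)
    ; Adj = GAdj
    ; sym = GAdj-sym
    ; irrefl = GAdj-irrefl
    }

module Submission where

-- Lower bound: the gadget H_m is a clique of m − 1 nodes joined to α leaves. While it burns
-- entirely, a round protecting fewer than m nodes leaves some clique node or leaf unprotected, and
-- that node keeps every node of the gadget burning.
-- Upper bound: first clear H^0 in α rounds, protecting its clique and one leaf per round. Then, for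
-- K = 1, …, m − 1 in turn: clean the arms of H^0, …, H^(K−1) and their attachment nodes; play the
-- (m − 1)-strategy for X while protecting c; protect c and the first nodes of the remaining arms,
-- and sweep those arms from c outwards; finally clear H^K as before. While H^K is being cleared,
-- the fire of the gadgets beyond K needs 2β + 2 ≥ α rounds to walk back to an earlier gadget.

open import Defs hiding (sym)
open import Level using (0ℓ)
open import Data.Nat using (ℕ; zero; suc; _≤_; _<_; _+_; _*_; _∸_; z≤n; s≤s; _≤?_; _<?_; _≟_)
open import Data.Nat.Properties
open import Data.Fin as Fin using (Fin; toℕ; fromℕ<)
open import Data.Fin.Properties using (toℕ<n; fromℕ<-toℕ; injective⇒≤; all?; ¬∀⟶∃¬)
open import Data.List using (List; []; _∷_; _++_; length; foldl; lookup; map; allFin)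
open import Data.List.Properties using (length-++; length-map; length-tabulate; foldl-++)
open import Data.List.Membership.Propositional using (_∈_)
open import Data.List.Membership.Propositional.Properties using (∈-++⁺ˡ; ∈-++⁺ʳ; ∈-map⁺; ∈-allFin)
open import Data.List.Relation.Unary.Any using (here; there; index; any?)
open import Data.List.Relation.Unary.Any.Properties using (lookup-index)
open import Data.List.Relation.Unary.All as All using (All; []; _∷_)
open import Data.List.Relation.Unary.All.Properties using () renaming (++⁺ to All-++⁺)
open import Data.Product using (_×_; _,_; proj₁; proj₂)
open import Data.Sum using (_⊎_; inj₁; inj₂)
open import Data.Unit using (⊤; tt)
open import Data.Empty using (⊥; ⊥-elim)
open import Function using (_∘′_)
open import Function.Definitions using (Injective)
open import Relation.Nullary using (¬_; Dec; yes; no; contradiction)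
open import Relation.Unary using (Pred; _⊆_; U; ∅)
open import Relation.Binary.Definitions using (tri<; tri≈; tri>)
open import Relation.Binary.PropositionalEquality using (_≡_; _≢_; refl; sym; trans; cong; subst)

m+n≡o⇒m≡o∸n : ∀ {m n o} → m + n ≡ o → m ≡ o ∸ n
m+n≡o⇒m≡o∸n {m} {n} eq = trans (sym (m+n∸n≡m m n)) (cong (_∸ n) eq)

module _ {A : Set} where

  length-++-≤ : ∀ (xs : List A) {ys a b} → length xs ≤ a → length ys ≤ b → length (xs ++ ys) ≤ a + b
  length-++-≤ xs l₁ l₂ = ≤-trans (≤-reflexive (length-++ xs)) (+-mono-≤ l₁ l₂)

  injection⇒≤-length : ∀ {n} {f : Fin n → A} {xs : List A} →
                       Injective _≡_ _≡_ f → (∀ x → f x ∈ xs) → n ≤ length xs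
  injection⇒≤-length {f = f} {xs} f-inj f∈xs = injective⇒≤ index-inj
    where
    index-inj : Injective _≡_ _≡_ (λ x → index (f∈xs x))
    index-inj {x} {y} eq = f-inj (trans (lookup-index (f∈xs x))
                                 (trans (cong (lookup xs) eq) (sym (lookup-index (f∈xs y)))))

  -- Indexes lists of nodes by the natural-number counters of the strategy; an out-of-range
  -- index gives the empty list.
  at : ∀ {n} → (Fin n → List A) → ℕ → List A
  at {n} f i with i <? n
  ... | yes i<n = f (fromℕ< i<n)
  ... | no _    = []

  length-at : ∀ {n k} (f : Fin n → List A) → (∀ x → length (f x) ≤ k) → ∀ i → length (at f i) ≤ k
  length-at {n} f bound i with i <? n
  ... | yes i<n = bound (fromℕ< i<n)
  ... | no _    = z≤n

  ∈-at : ∀ {n i v} {f : Fin n → List A} (x : Fin n) → toℕ x ≡ i → v ∈ f x → v ∈ at f i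
  ∈-at {n} {f = f} x refl v∈fx with toℕ x <? n
  ... | yes x<n = subst (λ y → _ ∈ f y) (sym (fromℕ<-toℕ x x<n)) v∈fx
  ... | no x≮n  = contradiction (toℕ<n x) x≮n

  entry : ∀ {n k} → (Fin n → Fin k → A) → ℕ → ℕ → List A
  entry f i j = at (λ x → at (λ y → f x y ∷ []) j) i

  length-entry : ∀ {n k} (f : Fin n → Fin k → A) i j → length (entry f i j) ≤ 1
  length-entry f i j = length-at (λ x → at (λ y → f x y ∷ []) j) (λ x → length-at (λ y → f x y ∷ []) (λ _ → ≤-refl) j) i

  ∈-entry : ∀ {n k i j} {f : Fin n → Fin k → A} {x y} → toℕ x ≡ i → toℕ y ≡ j → f x y ∈ entry f i j
  ∈-entry {x = x} {y} x≡i y≡j = ∈-at x x≡i (∈-at y y≡j (here refl))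

  concatFrom : (ℕ → List A) → ℕ → ℕ → List A
  concatFrom f a zero    = []
  concatFrom f a (suc n) = f a ++ concatFrom f (suc a) n

  concatRange : (ℕ → List A) → ℕ → ℕ → List A
  concatRange f a b = concatFrom f a (b ∸ a)

  length-concatFrom : ∀ (f : ℕ → List A) → (∀ x → length (f x) ≤ 1) → ∀ a n → length (concatFrom f a n) ≤ n
  length-concatFrom f bound a zero    = z≤n
  length-concatFrom f bound a (suc n) = length-++-≤ (f a) (bound a) (length-concatFrom f bound (suc a) n)

  length-concatRange : ∀ (f : ℕ → List A) → (∀ x → length (f x) ≤ 1) → ∀ a b → length (concatRange f a b) ≤ b ∸ a
  length-concatRange f bound a b = length-concatFrom f bound a (b ∸ a)

  ∈-concatFrom : ∀ (f : ℕ → List A) a n {x v} → a ≤ x → x < a + n → v ∈ f x → v ∈ concatFrom f a n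
  ∈-concatFrom f a zero    a≤x x<a+0 v∈ = contradiction (≤-trans x<a+0 (≤-reflexive (+-identityʳ a))) (≤⇒≯ a≤x)
  ∈-concatFrom f a (suc n) a≤x x<a+n v∈ with m≤n⇒m<n∨m≡n a≤x
  ... | inj₂ refl = ∈-++⁺ˡ v∈
  ... | inj₁ a<x  = ∈-++⁺ʳ (f a) (∈-concatFrom f (suc a) n a<x (≤-trans x<a+n (≤-reflexive (+-suc a n))) v∈)

  ∈-concatRange : ∀ (f : ℕ → List A) a b {x v} → a ≤ x → x < b → v ∈ f x → v ∈ concatRange f a b
  ∈-concatRange f a b a≤x x<b = ∈-concatFrom f a (b ∸ a) a≤x (≤-trans x<b (≤-reflexive (sym (m+[n∸m]≡n (≤-trans a≤x (<⇒≤ x<b))))))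

module Burning (G : Graph) where

  Region : Set₁
  Region = Pred (V G) 0ℓ

  burnFrom : Region → List (List (V G)) → Region
  burnFrom = foldl (step G)

  step-mono : ∀ {B B′} F → B ⊆ B′ → step G B F ⊆ step G B′ F
  step-mono F B⊆B′ (inj₁ (b , v∉F))          = inj₁ (B⊆B′ b , v∉F)
  step-mono F B⊆B′ (inj₂ (w , w~v , b , w∉F)) = inj₂ (w , w~v , B⊆B′ b , w∉F)

  Shielded : Region → List (V G) → V G → Set
  Shielded D F v = (D v → v ∈ F) × (∀ w → Adj G w v → D w → w ∈ F)

  shielded : ∀ {D F v} → Shielded D F v → ¬ step G D F v
  shielded (self , nbrs) (inj₁ (d , v∉F))          = v∉F (self d)
  shielded (self , nbrs) (inj₂ (w , w~v , d , w∉F)) = w∉F (nbrs w w~v d)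

module Plans (G : Graph) (m : ℕ) where
  open Burning G

  record Plan (D E : Region) : Set₁ where
    constructor plan
    field
      strategy      : List (List (V G))
      within-budget : All (λ F → length F ≤ m) strategy
      drives        : ∀ {B} → B ⊆ D → burnFrom B strategy ⊆ E

  infixr 4 _⨾_
  _⨾_ : ∀ {D E H} → Plan D E → Plan E H → Plan D H
  plan S₁ b₁ d₁ ⨾ plan S₂ b₂ d₂ =
    plan (S₁ ++ S₂) (All-++⁺ b₁ b₂)
         (λ {B} B⊆D v∈ → d₂ (d₁ B⊆D) (subst (λ R → R _) (foldl-++ (step G) B S₁ S₂) v∈))

  relax : ∀ {D E} → D ⊆ E → Plan D E
  relax D⊆E = plan [] [] (λ B⊆D → D⊆E ∘′ B⊆D)

  protect : ∀ {D E} F → length F ≤ m → step G D F ⊆ E → Plan D E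
  protect F |F|≤m stepD⊆E = plan (F ∷ []) (|F|≤m ∷ []) (λ B⊆D → stepD⊆E ∘′ step-mono F B⊆D)

  iterate : (D : ℕ → Region) {a b : ℕ} → a ≤ b → (∀ t → a ≤ t → t < b → Plan (D t) (D (suc t))) → Plan (D a) (D b)
  iterate D {b = zero}  z≤n  round = relax (λ d → d)
  iterate D {b = suc b} a≤1+b round with m≤n⇒m<n∨m≡n a≤1+b
  ... | inj₂ refl      = relax (λ d → d)
  ... | inj₁ (s≤s a≤b) = iterate D a≤b (λ t a≤t t<b → round t a≤t (m≤n⇒m≤1+n t<b)) ⨾ round b a≤b ≤-refl

  winnable : Plan U ∅ → Winnable G m
  winnable (plan S budget drives) = S , budget , λ v burns → drives (λ _ → tt) burns

module CliqueJoin (G : Graph) {n ℓ : ℕ} (clique : Fin n → V G) (leaf : Fin ℓ → V G) (some-leaf : Fin ℓ)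
  (clique-adj : ∀ {a a′} → a ≢ a′ → Adj G (clique a) (clique a′))
  (join : ∀ a b → Adj G (clique a) (leaf b))
  (clique-injective : Injective _≡_ _≡_ clique)
  (leaf≢clique : ∀ a b → leaf b ≢ clique a)
  (clique-≟ : ∀ a v → Dec (clique a ≡ v))
  (leaf-≟ : ∀ b v → Dec (leaf b ≡ v)) where
  open Burning G

  AllBurning : Region → Set
  AllBurning B = (∀ a → B (clique a)) × (∀ b → B (leaf b))

  protecting-clique-and-leaf-needs : ∀ {F} b → (∀ a → clique a ∈ F) → leaf b ∈ F → suc n ≤ length F
  protecting-clique-and-leaf-needs {F} b clique⊆F b∈F = injection⇒≤-length core-injective core∈F
    where
    core : Fin (suc n) → V G
    core Fin.zero    = leaf b
    core (Fin.suc a) = clique a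
    core-injective : Injective _≡_ _≡_ core
    core-injective {Fin.zero}  {Fin.zero}   _  = refl
    core-injective {Fin.zero}  {Fin.suc a}  eq = contradiction eq (leaf≢clique a b)
    core-injective {Fin.suc a} {Fin.zero}   eq = contradiction (sym eq) (leaf≢clique a b)
    core-injective {Fin.suc a} {Fin.suc a′} eq = cong Fin.suc (clique-injective eq)
    core∈F : ∀ x → core x ∈ F
    core∈F Fin.zero    = b∈F
    core∈F (Fin.suc a) = clique⊆F a

  keeps-burning : ∀ {B F} → length F ≤ n → AllBurning B → AllBurning (step G B F)
  keeps-burning {B} {F} |F|≤n (clique-burns , leaf-burns) = clique-stays , leaf-stays
    where
    clique∈? : ∀ a → Dec (clique a ∈ F)
    clique∈? a = any? (clique-≟ a) F
    leaf∈? : ∀ b → Dec (leaf b ∈ F)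
    leaf∈? b = any? (leaf-≟ b) F
    not-both : ∀ b → (∀ a → clique a ∈ F) → leaf b ∈ F → ⊥
    not-both b clique⊆F b∈F = <⇒≱ (s≤s |F|≤n) (protecting-clique-and-leaf-needs b clique⊆F b∈F)

    clique-stays : ∀ a → step G B F (clique a)
    clique-stays a with clique∈? a
    ... | no a∉F = inj₁ (clique-burns a , a∉F)
    ... | yes a∈F with all? clique∈?
    ...   | yes clique⊆F = inj₂ (leaf some-leaf , Graph.sym G (join a some-leaf) , leaf-burns some-leaf ,
                                 not-both some-leaf clique⊆F)
    ...   | no clique⊈F with ¬∀⟶∃¬ n _ clique∈? clique⊈F
    ...     | a′ , a′∉F = inj₂ (clique a′ , clique-adj (λ { refl → a′∉F a∈F }) , clique-burns a′ , a′∉F)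

    leaf-stays : ∀ b → step G B F (leaf b)
    leaf-stays b with leaf∈? b
    ... | no b∉F = inj₁ (leaf-burns b , b∉F)
    ... | yes b∈F with all? clique∈?
    ...   | yes clique⊆F = contradiction b∈F (not-both b clique⊆F)
    ...   | no clique⊈F with ¬∀⟶∃¬ n _ clique∈? clique⊈F
    ...     | a′ , a′∉F = inj₂ (clique a′ , join a′ b , clique-burns a′ , a′∉F)

  never-cleared : ∀ {B} S → All (λ F → length F ≤ n) S → AllBurning B → AllBurning (burnFrom B S)
  never-cleared []      []              burning = burning
  never-cleared (F ∷ S) (|F|≤n ∷ within) burning = never-cleared S within (keeps-burning |F|≤n burning)

module Construction (α β m : ℕ) (X : Graph) (u : Fin m → Fin (m ∸ 1)) where

  G : Graph
  G = Gm α β m X u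

  Node : Set
  Node = GV α β m (V X)

  open Burning G

  pathNode : ℕ → ℕ → List Node
  pathNode = entry path

  leafNode : ℕ → ℕ → List Node
  leafNode = entry hw

  attachment : ℕ → List Node
  attachment = at (λ i → hv i (u i) ∷ [])

  cliqueOf : ℕ → List Node
  cliqueOf = at (λ i → map (hv i) (allFin (m ∸ 1)))

  length-pathNode : ∀ i j → length (pathNode i j) ≤ 1
  length-pathNode = length-entry {A = Node} path

  length-leafNode : ∀ i b → length (leafNode i b) ≤ 1
  length-leafNode = length-entry {A = Node} hw

  length-attachment : ∀ i → length (attachment i) ≤ 1
  length-attachment = length-at {A = Node} (λ i → hv i (u i) ∷ []) (λ _ → ≤-refl)

  length-cliqueOf : ∀ i → length (cliqueOf i) ≤ m ∸ 1
  length-cliqueOf = length-at {A = Node} (λ i → map (hv i) (allFin (m ∸ 1)))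
    (λ i → ≤-reflexive (trans (length-map (hv i) (allFin (m ∸ 1))) (length-tabulate {n = m ∸ 1} (λ a → a))))

  ∈-pathNode : ∀ {i j a b} → toℕ i ≡ a → toℕ j ≡ b → path i j ∈ pathNode a b
  ∈-pathNode = ∈-entry

  ∈-leafNode : ∀ {i b k c} → toℕ i ≡ k → toℕ b ≡ c → hw i b ∈ leafNode k c
  ∈-leafNode = ∈-entry

  ∈-attachment : ∀ {i k} → toℕ i ≡ k → hv i (u i) ∈ attachment k
  ∈-attachment {i} i≡k = ∈-at i i≡k (here refl)

  ∈-cliqueOf : ∀ {i a k} → toℕ i ≡ k → hv i a ∈ cliqueOf k
  ∈-cliqueOf {i} {a} i≡k = ∈-at i i≡k (∈-map⁺ (hv i) (∈-allFin a))

  module _ (i : Fin m) (some-leaf : Fin α) where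

    private
      gadget-clique : Fin (m ∸ 1) → Node
      gadget-clique = hv i

      gadget-leaf : Fin α → Node
      gadget-leaf = hw i

      gadget-clique-injective : Injective _≡_ _≡_ gadget-clique
      gadget-clique-injective refl = refl

      leaf≢clique : ∀ a b → gadget-leaf b ≢ gadget-clique a
      leaf≢clique _ _ ()

      gadget-clique-≟ : ∀ a (v : Node) → Dec (hv i a ≡ v)
      gadget-clique-≟ a (hv i′ a′) with i Fin.≟ i′ | a Fin.≟ a′
      ... | yes refl | yes refl = yes refl
      ... | no i≢i′  | _        = no λ { refl → i≢i′ refl }
      ... | yes refl | no a≢a′  = no λ { refl → a≢a′ refl }
      gadget-clique-≟ a (old _)    = no λ ()
      gadget-clique-≟ a c          = no λ ()
      gadget-clique-≟ a (path _ _) = no λ ()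
      gadget-clique-≟ a (hw _ _)   = no λ ()

      gadget-leaf-≟ : ∀ b (v : Node) → Dec (hw i b ≡ v)
      gadget-leaf-≟ b (hw i′ b′) with i Fin.≟ i′ | b Fin.≟ b′
      ... | yes refl | yes refl = yes refl
      ... | no i≢i′  | _        = no λ { refl → i≢i′ refl }
      ... | yes refl | no b≢b′  = no λ { refl → b≢b′ refl }
      gadget-leaf-≟ b (old _)    = no λ ()
      gadget-leaf-≟ b c          = no λ ()
      gadget-leaf-≟ b (path _ _) = no λ ()
      gadget-leaf-≟ b (hv _ _)   = no λ ()

    open CliqueJoin G gadget-clique gadget-leaf some-leaf (λ a≢a′ → inj₁ (e-clique a≢a′)) (λ _ _ → inj₁ e-H)
                    gadget-clique-injective leaf≢clique gadget-clique-≟ gadget-leaf-≟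

    gadget-survives : ∀ k → k < m → ¬ Winnable G k
    gadget-survives k k<m (S , within , cleared) =
      cleared (hw i some-leaf) (proj₂ (never-cleared S (All.map (λ |F|≤k → ≤-trans |F|≤k k≤m∸1) within)
                                                     ((λ _ → tt) , (λ _ → tt))) some-leaf)
      where
      k≤m∸1 : k ≤ m ∸ 1
      k≤m∸1 = subst (k ≤_) (pred[m∸n]≡m∸[1+n] m 0) (<⇒≤pred k<m)

  module Strategy (1≤α : 1 ≤ α) (α≤2β+2 : α ≤ 2 * β + 2) (2≤m : 2 ≤ m) where
    open Plans G m

    1≤m : 1 ≤ m
    1≤m = ≤-trans (s≤s z≤n) 2≤m

    GadgetsClearBelow : ℕ → Region
    GadgetsClearBelow K (hv i a) = K ≤ toℕ i ⊎ a ≡ u i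
    GadgetsClearBelow K (hw i b) = K ≤ toℕ i
    GadgetsClearBelow K _        = ⊤

    -- Every burning node carries K < m, so that ClearedBelow m is empty.
    ClearedBelow : ℕ → Region
    ClearedBelow K v = K < m × GadgetsClearBelow K v

    gadgetMove : ℕ → ℕ → List Node
    gadgetMove K t = leafNode K t ++ cliqueOf K

    length-gadgetMove : ∀ K t → length (gadgetMove K t) ≤ m
    length-gadgetMove K t =
      ≤-trans (length-++-≤ (leafNode K t) (length-leafNode K t) (length-cliqueOf K)) (≤-reflexive (m+[n∸m]≡n 1≤m))

    module GadgetClearing {K t : ℕ} {D : Region} (leaves-scheduled : ∀ {i b} → toℕ i ≡ K → D (hw i b) → t ≤ toℕ b) where

      leaf-shielded : ∀ {i b} → toℕ i ≡ K → ¬ (t < toℕ b) → Shielded D (gadgetMove K t) (hw i b)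
      leaf-shielded {i} {b} i≡K t≮b =
        (λ d → ∈-++⁺ˡ (∈-leafNode i≡K (≤-antisym (≮⇒≥ t≮b) (leaves-scheduled i≡K d)))) , nbrs
        where
        nbrs : ∀ w → Adj G w (hw i b) → D w → w ∈ gadgetMove K t
        nbrs _ (inj₁ e-H) _ = ∈-++⁺ʳ (leafNode K t) (∈-cliqueOf i≡K)

      clique-shielded : ∀ {i a} → toℕ i ≡ K → suc t ≡ α → (a ≡ u i → ∀ j → ¬ D (path i j)) →
                        Shielded D (gadgetMove K t) (hv i a)
      clique-shielded {i} {a} i≡K 1+t≡α attachment-safe = (λ _ → in-clique) , nbrs
        where
        in-clique : ∀ {a′} → hv i a′ ∈ gadgetMove K t
        in-clique = ∈-++⁺ʳ (leafNode K t) (∈-cliqueOf i≡K)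
        nbrs : ∀ w → Adj G w (hv i a) → D w → w ∈ gadgetMove K t
        nbrs _ (inj₁ (e-pathH {j = j} _)) d = contradiction d (attachment-safe refl j)
        nbrs _ (inj₁ (e-clique _)) _ = in-clique
        nbrs _ (inj₂ (e-clique _)) _ = in-clique
        nbrs (hw _ b) (inj₂ e-H) d =
          ∈-++⁺ˡ (∈-leafNode i≡K (≤-antisym (≤-pred (subst (toℕ b <_) (sym 1+t≡α) (toℕ<n b))) (leaves-scheduled i≡K d)))

    ClearingFirstGadget : ℕ → Region
    ClearingFirstGadget t (hv i a) = 0 < toℕ i ⊎ t < α ⊎ a ≡ u i
    ClearingFirstGadget t (hw i b) = 0 < toℕ i ⊎ t ≤ toℕ b
    ClearingFirstGadget t _        = ⊤

    first-gadget-leaves : ∀ {t i b} → toℕ i ≡ 0 → ClearingFirstGadget t (hw i b) → t ≤ toℕ b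
    first-gadget-leaves i≡0 (inj₁ 0<i) = contradiction (sym i≡0) (<⇒≢ 0<i)
    first-gadget-leaves i≡0 (inj₂ t≤b) = t≤b

    clear-first-gadget-step : ∀ t → t < α → step G (ClearingFirstGadget t) (gadgetMove 0 t) ⊆ ClearingFirstGadget (suc t)
    clear-first-gadget-step t t<α {old _}    _ = tt
    clear-first-gadget-step t t<α {c}        _ = tt
    clear-first-gadget-step t t<α {path _ _} _ = tt
    clear-first-gadget-step t t<α {hv i a} burns with m≤n⇒m<n∨m≡n (z≤n {toℕ i})
    ... | inj₁ 0<i = inj₁ 0<i
    ... | inj₂ 0≡i with suc t <? α
    ...   | yes 1+t<α = inj₂ (inj₁ 1+t<α)
    ...   | no 1+t≮α with a Fin.≟ u i
    ...     | yes a≡u = inj₂ (inj₂ a≡u)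
    ...     | no a≢u  = contradiction burns (shielded (GadgetClearing.clique-shielded first-gadget-leaves
                                          (sym 0≡i) (≤-antisym t<α (≮⇒≥ 1+t≮α)) λ a≡u → contradiction a≡u a≢u))
    clear-first-gadget-step t t<α {hw i b} burns with m≤n⇒m<n∨m≡n (z≤n {toℕ i})
    ... | inj₁ 0<i = inj₁ 0<i
    ... | inj₂ 0≡i with suc t ≤? toℕ b
    ...   | yes t<b = inj₂ t<b
    ...   | no t≮b  = contradiction burns (shielded (GadgetClearing.leaf-shielded first-gadget-leaves (sym 0≡i) t≮b))

    clear-first-gadget : Plan U (ClearedBelow 1)
    clear-first-gadget =
      relax start ⨾
      iterate ClearingFirstGadget z≤n (λ t _ t<α → protect (gadgetMove 0 t) (length-gadgetMove 0 t) (clear-first-gadget-step t t<α)) ⨾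
      relax finish
      where
      start : U ⊆ ClearingFirstGadget 0
      start {old _}    _ = tt
      start {c}        _ = tt
      start {path _ _} _ = tt
      start {hv _ _}   _ = inj₂ (inj₁ 1≤α)
      start {hw _ _}   _ = inj₂ z≤n
      finish : ClearingFirstGadget α ⊆ ClearedBelow 1
      finish {old _}    _                  = 2≤m , tt
      finish {c}        _                  = 2≤m , tt
      finish {path _ _} _                  = 2≤m , tt
      finish {hv _ _}   (inj₁ 0<i)         = 2≤m , inj₁ 0<i
      finish {hv _ _}   (inj₂ (inj₁ α<α))  = contradiction α<α (<-irrefl refl)
      finish {hv _ _}   (inj₂ (inj₂ a≡u))  = 2≤m , inj₂ a≡u
      finish {hw _ _}   (inj₁ 0<i)         = 2≤m , 0<i
      finish {hw _ b}   (inj₂ α≤b)         = contradiction (toℕ<n b) (≤⇒≯ α≤b)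

    Restoring : ℕ → ℕ → ℕ → Region
    Restoring K p q (path i j) = p < toℕ i ⊎ (toℕ i ≡ p × toℕ j + q ≤ β)
    Restoring K p q (hv i a)   = K ≤ toℕ i ⊎ (a ≡ u i × (p < toℕ i ⊎ (toℕ i ≡ p × q ≡ 0)))
    Restoring K p q (hw i b)   = K ≤ toℕ i
    Restoring K p q _          = ⊤

    previousOnArm : ℕ → ℕ → List Node
    previousOnArm p zero    = c ∷ []
    previousOnArm p (suc j) = pathNode p j

    -- Arm p is cleaned from the gadget end inwards, one node per round; the burning neighbour of
    -- the node being cleaned is protected with it, so that it cannot relight it.
    restoreFront : ℕ → ℕ → List Node
    restoreFront p zero    = attachment p ++ pathNode p (β ∸ 1)
    restoreFront p (suc r) = pathNode p (β ∸ suc r) ++ previousOnArm p (β ∸ suc r)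

    -- Once an arm below p is clean, the centre must not be allowed to spread into it.
    centreIfPositive : ℕ → List Node
    centreIfPositive zero    = []
    centreIfPositive (suc _) = c ∷ []

    restoreMove : ℕ → ℕ → ℕ → List Node
    restoreMove K p q = restoreFront p q ++ (concatRange attachment (suc p) K ++ centreIfPositive p)

    length-restoreMove : ∀ K p q → p < K → K < m → length (restoreMove K p q) ≤ m
    length-restoreMove K p q p<K K<m =
      ≤-trans (length-++-≤ (restoreFront p q) (length-restoreFront q)
                (length-++-≤ (concatRange attachment (suc p) K) (length-concatRange attachment length-attachment (suc p) K)
                             (length-centreIfPositive p)))
              (≤-trans (≤-reflexive budget) K<m)
      where
      length-previousOnArm : ∀ j → length (previousOnArm p j) ≤ 1
      length-previousOnArm zero    = ≤-refl
      length-previousOnArm (suc j) = length-pathNode p j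
      length-restoreFront : ∀ q → length (restoreFront p q) ≤ 2
      length-restoreFront zero    = length-++-≤ (attachment p) (length-attachment p) (length-pathNode p (β ∸ 1))
      length-restoreFront (suc r) = length-++-≤ (pathNode p (β ∸ suc r)) (length-pathNode p (β ∸ suc r))
                                                (length-previousOnArm (β ∸ suc r))
      length-centreIfPositive : ∀ p → length (centreIfPositive p) ≤ p
      length-centreIfPositive zero    = z≤n
      length-centreIfPositive (suc p) = s≤s z≤n
      budget : 2 + ((K ∸ suc p) + p) ≡ suc K
      budget = cong suc (trans (sym (+-suc (K ∸ suc p) p)) (m∸n+n≡m p<K))

    module RestoreArm (K p : ℕ) (p<K : p < K) where

      private
        attachment∈ : ∀ q i → p < toℕ i → toℕ i < K → hv i (u i) ∈ restoreMove K p q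
        attachment∈ q i p<i i<K =
          ∈-++⁺ʳ (restoreFront p q) (∈-++⁺ˡ (∈-concatRange attachment (suc p) K p<i i<K (∈-attachment refl)))
        centre∈ : ∀ q → 0 < p → c ∈ restoreMove K p q
        centre∈ q (s≤s z≤n) = ∈-++⁺ʳ (restoreFront p q) (∈-++⁺ʳ (concatRange attachment (suc p) K) (here refl))
        own-attachment∈ : ∀ i → toℕ i ≡ p → hv i (u i) ∈ restoreMove K p 0
        own-attachment∈ i i≡p = ∈-++⁺ˡ (∈-++⁺ˡ (∈-attachment i≡p))
        last∈ : ∀ i j → toℕ i ≡ p → toℕ j ≡ β ∸ 1 → path i j ∈ restoreMove K p 0
        last∈ i j i≡p j≡ = ∈-++⁺ˡ (∈-++⁺ʳ (attachment p) (∈-pathNode i≡p j≡))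
        front∈ : ∀ r i j → toℕ i ≡ p → toℕ j ≡ β ∸ suc r → path i j ∈ restoreMove K p (suc r)
        front∈ r i j i≡p j≡ = ∈-++⁺ˡ (∈-++⁺ˡ (∈-pathNode i≡p j≡))
        previous∈ : ∀ r i j → toℕ i ≡ p → β ∸ suc r ≡ suc (toℕ j) → path i j ∈ restoreMove K p (suc r)
        previous∈ r i j i≡p eq =
          ∈-++⁺ˡ (∈-++⁺ʳ (pathNode p (β ∸ suc r)) (subst (λ n → path i j ∈ previousOnArm p n) (sym eq) (∈-pathNode i≡p refl)))
        previous-centre∈ : ∀ r → β ∸ suc r ≡ 0 → c ∈ restoreMove K p (suc r)
        previous-centre∈ r eq =
          ∈-++⁺ˡ (∈-++⁺ʳ (pathNode p (β ∸ suc r)) (subst (λ n → c ∈ previousOnArm p n) (sym eq) (here refl)))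
        attachment-burning∈ : ∀ q i → toℕ i < K → p < toℕ i ⊎ (toℕ i ≡ p × q ≡ 0) → hv i (u i) ∈ restoreMove K p q
        attachment-burning∈ q i i<K (inj₁ p<i)          = attachment∈ q i p<i i<K
        attachment-burning∈ .0 i i<K (inj₂ (i≡p , refl)) = own-attachment∈ i i≡p

      front-shielded : ∀ r i j → toℕ i ≡ p → β ≤ toℕ j + suc r →
                       Shielded (Restoring K p (suc r)) (restoreMove K p (suc r)) (path i j)
      front-shielded r i j i≡p β≤j+r+1 = self , nbrs
        where
        self : Restoring K p (suc r) (path i j) → path i j ∈ restoreMove K p (suc r)
        self (inj₁ p<i)      = ⊥-elim (<-irrefl (sym i≡p) p<i)
        self (inj₂ (_ , le)) = front∈ r i j i≡p (m+n≡o⇒m≡o∸n (≤-antisym le β≤j+r+1))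
        nbrs : ∀ w → Adj G w (path i j) → Restoring K p (suc r) w → w ∈ restoreMove K p (suc r)
        nbrs _ (inj₁ (e-cpath j≡0)) _ =
          previous-centre∈ r (m≤n⇒m∸n≡0 (≤-trans β≤j+r+1 (≤-reflexive (cong (_+ suc r) j≡0))))
        nbrs (path _ j₀) (inj₁ (e-path _)) (inj₁ p<i) = ⊥-elim (<-irrefl (sym i≡p) p<i)
        nbrs (path _ j₀) (inj₁ (e-path j≡1+j₀)) (inj₂ (_ , le)) with m≤n⇒m<n∨m≡n le
        ... | inj₂ eq = front∈ r i j₀ i≡p (m+n≡o⇒m≡o∸n eq)
        ... | inj₁ lt = previous∈ r i j₀ i≡p (trans (sym (m+n≡o⇒m≡o∸n j+r+1≡β)) j≡1+j₀)
          where
          j+r+1≡β : toℕ j + suc r ≡ β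
          j+r+1≡β = ≤-antisym (≤-trans (≤-reflexive (cong (_+ suc r) j≡1+j₀)) lt) β≤j+r+1
        nbrs (path _ j₁) (inj₂ (e-path _)) (inj₁ p<i) = ⊥-elim (<-irrefl (sym i≡p) p<i)
        nbrs (path _ j₁) (inj₂ (e-path j₁≡1+j)) (inj₂ (_ , le)) =
          ⊥-elim (<-irrefl refl (≤-trans (s≤s β≤j+r+1) (≤-trans (≤-reflexive (cong (_+ suc r) (sym j₁≡1+j))) le)))
        nbrs _ (inj₂ (e-pathH _)) (inj₁ K≤i) = ⊥-elim (<-irrefl refl (≤-trans p<K (≤-trans K≤i (≤-reflexive i≡p))))
        nbrs _ (inj₂ (e-pathH _)) (inj₂ (_ , inj₁ p<i)) = ⊥-elim (<-irrefl (sym i≡p) p<i)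
        nbrs _ (inj₂ (e-pathH _)) (inj₂ (_ , inj₂ (_ , ())))

      earlier-arm-shielded : ∀ q i j → toℕ i < p → Shielded (Restoring K p q) (restoreMove K p q) (path i j)
      earlier-arm-shielded q i j i<p = self , nbrs
        where
        self : Restoring K p q (path i j) → path i j ∈ restoreMove K p q
        self (inj₁ p<i)     = ⊥-elim (<-asym i<p p<i)
        self (inj₂ (i≡p , _)) = ⊥-elim (<-irrefl i≡p i<p)
        nbrs : ∀ w → Adj G w (path i j) → Restoring K p q w → w ∈ restoreMove K p q
        nbrs _ (inj₁ (e-cpath _)) _                   = centre∈ q (≤-trans (s≤s z≤n) i<p)
        nbrs _ (inj₁ (e-path _)) (inj₁ p<i)           = ⊥-elim (<-asym i<p p<i)
        nbrs _ (inj₁ (e-path _)) (inj₂ (i≡p , _))     = ⊥-elim (<-irrefl i≡p i<p)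
        nbrs _ (inj₂ (e-path _)) (inj₁ p<i)           = ⊥-elim (<-asym i<p p<i)
        nbrs _ (inj₂ (e-path _)) (inj₂ (i≡p , _))     = ⊥-elim (<-irrefl i≡p i<p)
        nbrs _ (inj₂ (e-pathH _)) (inj₁ K≤i)          = ⊥-elim (<-irrefl refl (≤-trans i<p (≤-trans (<⇒≤ p<K) K≤i)))
        nbrs _ (inj₂ (e-pathH _)) (inj₂ (_ , inj₁ p<i)) = ⊥-elim (<-asym i<p p<i)
        nbrs _ (inj₂ (e-pathH _)) (inj₂ (_ , inj₂ (i≡p , _))) = ⊥-elim (<-irrefl i≡p i<p)

      clique-shielded : ∀ q i a → toℕ i < K → a ≢ u i → Shielded (Restoring K p q) (restoreMove K p q) (hv i a)
      clique-shielded q i a i<K a≢u = self , nbrs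
        where
        self : Restoring K p q (hv i a) → hv i a ∈ restoreMove K p q
        self (inj₁ K≤i)      = ⊥-elim (<⇒≱ i<K K≤i)
        self (inj₂ (a≡u , _)) = ⊥-elim (a≢u a≡u)
        nbrs : ∀ w → Adj G w (hv i a) → Restoring K p q w → w ∈ restoreMove K p q
        nbrs _ (inj₁ (e-pathH _)) _                     = ⊥-elim (a≢u refl)
        nbrs _ (inj₁ (e-clique _)) (inj₁ K≤i)           = ⊥-elim (<⇒≱ i<K K≤i)
        nbrs _ (inj₁ (e-clique _)) (inj₂ (refl , burning)) = attachment-burning∈ q i i<K burning
        nbrs _ (inj₂ (e-clique _)) (inj₁ K≤i)           = ⊥-elim (<⇒≱ i<K K≤i)
        nbrs _ (inj₂ (e-clique _)) (inj₂ (refl , burning)) = attachment-burning∈ q i i<K burning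
        nbrs _ (inj₂ e-H) K≤i                           = ⊥-elim (<⇒≱ i<K K≤i)

      attachment-shielded : ∀ q i → toℕ i < K → toℕ i ≤ p → Shielded (Restoring K p q) (restoreMove K p q) (hv i (u i))
      attachment-shielded q i i<K i≤p = self , nbrs
        where
        self : Restoring K p q (hv i (u i)) → hv i (u i) ∈ restoreMove K p q
        self (inj₁ K≤i)                   = ⊥-elim (<⇒≱ i<K K≤i)
        self (inj₂ (_ , inj₁ p<i))        = ⊥-elim (<⇒≱ p<i i≤p)
        self (inj₂ (_ , inj₂ (i≡p , refl))) = own-attachment∈ i i≡p
        last-node : ∀ q j → suc (toℕ j) ≡ β → Restoring K p q (path i j) → path i j ∈ restoreMove K p q
        last-node q j _ (inj₁ p<i) = ⊥-elim (<⇒≱ p<i i≤p)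
        last-node zero j 1+j≡β (inj₂ (i≡p , _)) = last∈ i j i≡p (m+n≡o⇒m≡o∸n (trans (+-comm (toℕ j) 1) 1+j≡β))
        last-node (suc zero) j 1+j≡β (inj₂ (i≡p , _)) = front∈ 0 i j i≡p (m+n≡o⇒m≡o∸n (trans (+-comm (toℕ j) 1) 1+j≡β))
        last-node (suc (suc r)) j 1+j≡β (inj₂ (_ , le)) =
          ⊥-elim (<-irrefl refl (≤-trans (≤-reflexive (trans (cong suc (sym 1+j≡β)) (sym (+-comm (toℕ j) 2))))
                                         (≤-trans (+-monoʳ-≤ (toℕ j) (s≤s (s≤s z≤n))) le)))
        nbrs : ∀ w → Adj G w (hv i (u i)) → Restoring K p q w → w ∈ restoreMove K p q
        nbrs _ (inj₁ (e-pathH 1+j≡β)) d              = last-node q _ 1+j≡β d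
        nbrs _ (inj₁ (e-clique _)) (inj₁ K≤i)        = ⊥-elim (<⇒≱ i<K K≤i)
        nbrs _ (inj₁ (e-clique a≢u)) (inj₂ (refl , _)) = ⊥-elim (a≢u refl)
        nbrs _ (inj₂ (e-clique _)) (inj₁ K≤i)        = ⊥-elim (<⇒≱ i<K K≤i)
        nbrs _ (inj₂ (e-clique u≢a)) (inj₂ (refl , _)) = ⊥-elim (u≢a refl)
        nbrs _ (inj₂ e-H) K≤i                        = ⊥-elim (<⇒≱ i<K K≤i)

      leaf-shielded : ∀ q i b → toℕ i < K → Shielded (Restoring K p q) (restoreMove K p q) (hw i b)
      leaf-shielded q i b i<K = (λ K≤i → ⊥-elim (<⇒≱ i<K K≤i)) , nbrs
        where
        nbrs : ∀ w → Adj G w (hw i b) → Restoring K p q w → w ∈ restoreMove K p q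
        nbrs _ (inj₁ e-H) (inj₁ K≤i)           = ⊥-elim (<⇒≱ i<K K≤i)
        nbrs _ (inj₁ e-H) (inj₂ (refl , burning)) = attachment-burning∈ q i i<K burning

      restore-step : ∀ q → q ≤ β → step G (Restoring K p q) (restoreMove K p q) ⊆ Restoring K p (suc q)
      restore-step q q≤β {old _} _ = tt
      restore-step q q≤β {c}     _ = tt
      restore-step q q≤β {path i j} burns with p <? toℕ i
      ... | yes p<i = inj₁ p<i
      ... | no p≮i with toℕ i ≟ p
      ...   | no i≢p = ⊥-elim (shielded (earlier-arm-shielded q i j (≤∧≢⇒< (≮⇒≥ p≮i) i≢p)) burns)
      ...   | yes i≡p with toℕ j + suc q ≤? β
      ...     | yes le = inj₂ (i≡p , le)
      ...     | no j+q+1≰β = ⊥-elim (cleaned q q≤β j+q+1≰β burns)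
        where
        cleaned : ∀ q → q ≤ β → ¬ (toℕ j + suc q ≤ β) → ¬ step G (Restoring K p q) (restoreMove K p q) (path i j)
        cleaned zero    _   j+1≰β _     = j+1≰β (≤-trans (≤-reflexive (+-comm (toℕ j) 1)) (toℕ<n j))
        cleaned (suc r) r<β j+r+2≰β burns =
          shielded (front-shielded r i j i≡p (≤-pred (≤-trans (≰⇒> j+r+2≰β) (≤-reflexive (+-suc (toℕ j) (suc r)))))) burns
      restore-step q q≤β {hv i a} burns with K ≤? toℕ i
      ... | yes K≤i = inj₁ K≤i
      ... | no K≰i with a Fin.≟ u i
      ...   | no a≢u = ⊥-elim (shielded (clique-shielded q i a (≰⇒> K≰i) a≢u) burns)
      ...   | yes refl with p <? toℕ i
      ...     | yes p<i = inj₂ (refl , inj₁ p<i)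
      ...     | no p≮i  = ⊥-elim (shielded (attachment-shielded q i (≰⇒> K≰i) (≮⇒≥ p≮i)) burns)
      restore-step q q≤β {hw i b} burns with K ≤? toℕ i
      ... | yes K≤i = K≤i
      ... | no K≰i  = ⊥-elim (shielded (leaf-shielded q i b (≰⇒> K≰i)) burns)

    restore : ∀ K → K < m → Plan (ClearedBelow K) (Restoring K K 0)
    restore K K<m = relax start ⨾ iterate (λ p → Restoring K p 0) z≤n (λ p _ → restore-arm p)
      where
      j+0≤β : ∀ (j : Fin β) → toℕ j + 0 ≤ β
      j+0≤β j = ≤-trans (≤-reflexive (+-identityʳ (toℕ j))) (<⇒≤ (toℕ<n j))

      start : ClearedBelow K ⊆ Restoring K 0 0
      start {old _} _ = tt
      start {c}     _ = tt
      start {path i j} _ with m≤n⇒m<n∨m≡n (z≤n {toℕ i})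
      ... | inj₁ 0<i = inj₁ 0<i
      ... | inj₂ 0≡i = inj₂ (sym 0≡i , j+0≤β j)
      start {hv i a} (_ , inj₁ K≤i) = inj₁ K≤i
      start {hv i a} (_ , inj₂ a≡u) with m≤n⇒m<n∨m≡n (z≤n {toℕ i})
      ... | inj₁ 0<i = inj₂ (a≡u , inj₁ 0<i)
      ... | inj₂ 0≡i = inj₂ (a≡u , inj₂ (sym 0≡i , refl))
      start {hw i b} (_ , K≤i) = K≤i

      next-arm : ∀ p → Restoring K p (suc β) ⊆ Restoring K (suc p) 0
      next-arm p {old _} _ = tt
      next-arm p {c}     _ = tt
      next-arm p {path i j} (inj₁ p<i) with m≤n⇒m<n∨m≡n p<i
      ... | inj₁ p+1<i = inj₁ p+1<i
      ... | inj₂ p+1≡i = inj₂ (sym p+1≡i , j+0≤β j)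
      next-arm p {path i j} (inj₂ (_ , j+β+1≤β)) =
        ⊥-elim (<-irrefl refl (≤-trans (s≤s (m≤n+m β (toℕ j))) (≤-trans (≤-reflexive (sym (+-suc (toℕ j) β))) j+β+1≤β)))
      next-arm p {hv i a} (inj₁ K≤i) = inj₁ K≤i
      next-arm p {hv i a} (inj₂ (a≡u , inj₁ p<i)) with m≤n⇒m<n∨m≡n p<i
      ... | inj₁ p+1<i = inj₂ (a≡u , inj₁ p+1<i)
      ... | inj₂ p+1≡i = inj₂ (a≡u , inj₂ (sym p+1≡i , refl))
      next-arm p {hv i a} (inj₂ (_ , inj₂ (_ , ())))
      next-arm p {hw i b} K≤i = K≤i

      restore-arm : ∀ p → p < K → Plan (Restoring K p 0) (Restoring K (suc p) 0)
      restore-arm p p<K =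
        iterate (Restoring K p) z≤n
          (λ q _ q<1+β → protect (restoreMove K p q) (length-restoreMove K p q p<K K<m) (RestoreArm.restore-step K p p<K q (≤-pred q<1+β))) ⨾
        relax (next-arm p)

    OnArmBelow : ℕ → Region
    OnArmBelow K (path i _) = toℕ i < K
    OnArmBelow K (hv i _)   = toℕ i < K
    OnArmBelow K (hw i _)   = toℕ i < K
    OnArmBelow K _          = ⊥

    neighbour-on-arm : ∀ {K v w} → Adj G w v → OnArmBelow K v → w ≡ c ⊎ OnArmBelow K w
    neighbour-on-arm {v = path _ _} (inj₁ (e-cpath _))  _   = inj₁ refl
    neighbour-on-arm {v = path _ _} (inj₁ (e-path _))   i<K = inj₂ i<K
    neighbour-on-arm {v = path _ _} (inj₂ (e-path _))   i<K = inj₂ i<K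
    neighbour-on-arm {v = path _ _} (inj₂ (e-pathH _))  i<K = inj₂ i<K
    neighbour-on-arm {v = hv _ _}   (inj₁ (e-pathH _))  i<K = inj₂ i<K
    neighbour-on-arm {v = hv _ _}   (inj₁ (e-clique _)) i<K = inj₂ i<K
    neighbour-on-arm {v = hv _ _}   (inj₂ (e-clique _)) i<K = inj₂ i<K
    neighbour-on-arm {v = hv _ _}   (inj₂ e-H)          i<K = inj₂ i<K
    neighbour-on-arm {v = hw _ _}   (inj₁ e-H)          i<K = inj₂ i<K

    lower-arms-stay-clean : ∀ {K D F v} → (∀ {w} → D w → ¬ OnArmBelow K w) → (D c → c ∈ F) →
                            step G D F v → ¬ OnArmBelow K v
    lower-arms-stay-clean confined centre (inj₁ (d , _)) on = confined d on
    lower-arms-stay-clean confined centre (inj₂ (w , w~v , d , w∉F)) on with neighbour-on-arm w~v on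
    ... | inj₁ refl = w∉F (centre d)
    ... | inj₂ on′  = confined d on′

    XPhase : ℕ → Pred (V X) 0ℓ → Region
    XPhase K B (old x)    = B x
    XPhase K B c          = ⊤
    XPhase K B (path i _) = K ≤ toℕ i
    XPhase K B (hv i _)   = K ≤ toℕ i
    XPhase K B (hw i _)   = K ≤ toℕ i

    xphase-confined : ∀ {K B w} → XPhase K B w → ¬ OnArmBelow K w
    xphase-confined {w = path _ _} K≤i i<K = <⇒≱ i<K K≤i
    xphase-confined {w = hv _ _}   K≤i i<K = <⇒≱ i<K K≤i
    xphase-confined {w = hw _ _}   K≤i i<K = <⇒≱ i<K K≤i

    enter-xphase : ∀ K → Restoring K K 0 ⊆ XPhase K U
    enter-xphase K {old _}    _                        = tt
    enter-xphase K {c}        _                        = tt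
    enter-xphase K {path _ _} (inj₁ K<i)               = <⇒≤ K<i
    enter-xphase K {path _ _} (inj₂ (i≡K , _))         = ≤-reflexive (sym i≡K)
    enter-xphase K {hv _ _}   (inj₁ K≤i)               = K≤i
    enter-xphase K {hv _ _}   (inj₂ (_ , inj₁ K<i))    = <⇒≤ K<i
    enter-xphase K {hv _ _}   (inj₂ (_ , inj₂ (i≡K , _))) = ≤-reflexive (sym i≡K)
    enter-xphase K {hw _ _}   K≤i                      = K≤i

    xPhaseMove : List (V X) → List Node
    xPhaseMove Fx = c ∷ map old Fx

    xphase-step : ∀ K B Fx → step G (XPhase K B) (xPhaseMove Fx) ⊆ XPhase K (step X B Fx)
    xphase-step K B Fx {old x} (inj₁ (b , x∉F)) = inj₁ (b , λ x∈Fx → x∉F (there (∈-map⁺ old x∈Fx)))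
    xphase-step K B Fx {old x} (inj₂ (_ , inj₁ (e-X {a = y} y~x) , b , y∉F)) =
      inj₂ (y , y~x , b , λ y∈Fx → y∉F (there (∈-map⁺ old y∈Fx)))
    xphase-step K B Fx {old x} (inj₂ (_ , inj₂ (e-X {b = y} x~y) , b , y∉F)) =
      inj₂ (y , Graph.sym X x~y , b , λ y∈Fx → y∉F (there (∈-map⁺ old y∈Fx)))
    xphase-step K B Fx {old x} (inj₂ (_ , inj₁ e-cX , _ , c∉F)) = ⊥-elim (c∉F (here refl))
    xphase-step K B Fx {c}        _     = tt
    xphase-step K B Fx {path _ _} burns = ≮⇒≥ (lower-arms-stay-clean xphase-confined (λ _ → here refl) burns)
    xphase-step K B Fx {hv _ _}   burns = ≮⇒≥ (lower-arms-stay-clean xphase-confined (λ _ → here refl) burns)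
    xphase-step K B Fx {hw _ _}   burns = ≮⇒≥ (lower-arms-stay-clean xphase-confined (λ _ → here refl) burns)

    play-X : ∀ K {B} SX → All (λ F → length F ≤ m ∸ 1) SX → Plan (XPhase K B) (XPhase K (Burning.burnFrom X B SX))
    play-X K []        []               = relax (λ d → d)
    play-X K (Fx ∷ SX) (|Fx|≤m-1 ∷ within) =
      protect (xPhaseMove Fx) (≤-trans (s≤s (≤-trans (≤-reflexive (length-map old Fx)) |Fx|≤m-1)) (≤-reflexive (m+[n∸m]≡n 1≤m)))
              (xphase-step K _ Fx) ⨾
      play-X K SX within

    Sweeping : ℕ → ℕ → ℕ → Region
    Sweeping K j s (path i jj) = j < toℕ i ⊎ (toℕ i ≡ j × s ≤ toℕ jj)
    Sweeping K j s (hv i _)    = K ≤ toℕ i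
    Sweeping K j s (hw i _)    = K ≤ toℕ i
    Sweeping K j s _           = ⊥

    sweeping-confined : ∀ {K j s w} → K ≤ j → Sweeping K j s w → ¬ OnArmBelow K w
    sweeping-confined {w = path _ _} K≤j (inj₁ j<i)       i<K = <-asym i<K (≤-trans (s≤s K≤j) j<i)
    sweeping-confined {w = path _ _} K≤j (inj₂ (i≡j , _)) i<K = <⇒≱ i<K (≤-trans K≤j (≤-reflexive (sym i≡j)))
    sweeping-confined {w = hv _ _}   _   K≤i              i<K = <⇒≱ i<K K≤i
    sweeping-confined {w = hw _ _}   _   K≤i              i<K = <⇒≱ i<K K≤i

    firstNodesFrom : ℕ → List Node
    firstNodesFrom a = concatRange (λ i → pathNode i 0) a m

    ∈-firstNodesFrom : ∀ {a i j} → a ≤ toℕ i → toℕ j ≡ 0 → path i j ∈ firstNodesFrom a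
    ∈-firstNodesFrom {a} {i} a≤i j≡0 = ∈-concatRange (λ i → pathNode i 0) a m a≤i (toℕ<n i) (∈-pathNode refl j≡0)

    length-firstNodesFrom : ∀ a → length (firstNodesFrom a) ≤ m ∸ a
    length-firstNodesFrom a = length-concatRange (λ i → pathNode i 0) (λ i → length-pathNode i 0) a m

    clearCentreMove : ℕ → List Node
    clearCentreMove K = c ∷ firstNodesFrom K

    length-clearCentreMove : ∀ K → 1 ≤ K → length (clearCentreMove K) ≤ m
    length-clearCentreMove K 1≤K =
      ≤-trans (s≤s (≤-trans (length-firstNodesFrom K) (∸-monoʳ-≤ m 1≤K))) (≤-reflexive (m+[n∸m]≡n 1≤m))

    clear-centre-step : ∀ K {Bx} → (∀ x → ¬ Bx x) → step G (XPhase K Bx) (clearCentreMove K) ⊆ Sweeping K K 0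
    clear-centre-step K cleared {old x} burns = shielded ((λ d → ⊥-elim (cleared x d)) , nbrs) burns
      where
      nbrs : ∀ w → Adj G w (old x) → XPhase K _ w → w ∈ clearCentreMove K
      nbrs _ (inj₁ (e-X {a = y} _)) d = ⊥-elim (cleared y d)
      nbrs _ (inj₂ (e-X {b = y} _)) d = ⊥-elim (cleared y d)
      nbrs _ (inj₁ e-cX)            _ = here refl
    clear-centre-step K cleared {c} burns = shielded ((λ _ → here refl) , nbrs) burns
      where
      nbrs : ∀ w → Adj G w c → XPhase K _ w → w ∈ clearCentreMove K
      nbrs _ (inj₂ (e-cX {a = y}))  d   = ⊥-elim (cleared y d)
      nbrs _ (inj₂ (e-cpath j≡0))   K≤i = there (∈-firstNodesFrom K≤i j≡0)
    clear-centre-step K cleared {path i j} burns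
      with m≤n⇒m<n∨m≡n (≮⇒≥ (lower-arms-stay-clean xphase-confined (λ _ → here refl) burns))
    ... | inj₁ K<i = inj₁ K<i
    ... | inj₂ K≡i = inj₂ (sym K≡i , z≤n)
    clear-centre-step K cleared {hv _ _} burns = ≮⇒≥ (lower-arms-stay-clean xphase-confined (λ _ → here refl) burns)
    clear-centre-step K cleared {hw _ _} burns = ≮⇒≥ (lower-arms-stay-clean xphase-confined (λ _ → here refl) burns)

    nextOnArm : ℕ → ℕ → List Node
    nextOnArm j s with suc s <? β
    ... | yes _ = pathNode j (suc s)
    ... | no _  = attachment j

    length-nextOnArm : ∀ j s → length (nextOnArm j s) ≤ 1
    length-nextOnArm j s with suc s <? β
    ... | yes _ = length-pathNode j (suc s)
    ... | no _  = length-attachment j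

    ∈-nextOnArm-path : ∀ {j s i jj} → toℕ i ≡ j → toℕ jj ≡ suc s → path i jj ∈ nextOnArm j s
    ∈-nextOnArm-path {j} {s} {jj = jj} i≡j jj≡1+s with suc s <? β
    ... | yes _    = ∈-pathNode i≡j jj≡1+s
    ... | no 1+s≮β = ⊥-elim (1+s≮β (subst (_< β) jj≡1+s (toℕ<n jj)))

    ∈-nextOnArm-attachment : ∀ {j s i} → toℕ i ≡ j → suc s ≡ β → hv i (u i) ∈ nextOnArm j s
    ∈-nextOnArm-attachment {j} {s} i≡j 1+s≡β with suc s <? β
    ... | yes 1+s<β = ⊥-elim (<-irrefl 1+s≡β 1+s<β)
    ... | no _      = ∈-attachment i≡j

    -- While arm j is swept from the centre outwards, the first nodes of the later arms keep
    -- the fire away from the centre, and the attachments of the swept arms keep it off them.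
    sweepMove : ℕ → ℕ → ℕ → List Node
    sweepMove K j s = pathNode j s ++ (nextOnArm j s ++ (firstNodesFrom (suc j) ++ concatRange attachment K j))

    length-sweepMove : ∀ K j s → 1 ≤ K → K ≤ j → j < m → length (sweepMove K j s) ≤ m
    length-sweepMove K j s 1≤K K≤j j<m =
      ≤-trans (length-++-≤ (pathNode j s) (length-pathNode j s)
                (length-++-≤ (nextOnArm j s) (length-nextOnArm j s)
                  (length-++-≤ (firstNodesFrom (suc j)) (length-firstNodesFrom (suc j))
                               (length-concatRange attachment length-attachment K j))))
              budget
      where
      open ≤-Reasoning
      1+[j∸K]≤j : suc (j ∸ K) ≤ j
      1+[j∸K]≤j = begin
        suc (j ∸ K)   ≡⟨ +-comm 1 (j ∸ K) ⟩
        (j ∸ K) + 1   ≤⟨ +-monoʳ-≤ (j ∸ K) 1≤K ⟩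
        (j ∸ K) + K   ≡⟨ m∸n+n≡m K≤j ⟩
        j             ∎
      budget : 1 + (1 + ((m ∸ suc j) + (j ∸ K))) ≤ m
      budget = begin
        suc (suc ((m ∸ suc j) + (j ∸ K)))  ≡⟨ cong suc (sym (+-suc (m ∸ suc j) (j ∸ K))) ⟩
        suc ((m ∸ suc j) + suc (j ∸ K))    ≡⟨ sym (+-suc (m ∸ suc j) (suc (j ∸ K))) ⟩
        (m ∸ suc j) + suc (suc (j ∸ K))    ≤⟨ +-monoʳ-≤ (m ∸ suc j) (s≤s 1+[j∸K]≤j) ⟩
        (m ∸ suc j) + suc j                ≡⟨ m∸n+n≡m j<m ⟩
        m                                  ∎

    module SweepArm (K j : ℕ) (K≤j : K ≤ j) where

      private
        current∈ : ∀ s i jj → toℕ i ≡ j → toℕ jj ≡ s → path i jj ∈ sweepMove K j s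
        current∈ s i jj i≡j jj≡s = ∈-++⁺ˡ (∈-pathNode i≡j jj≡s)
        next∈ : ∀ s {v} → v ∈ nextOnArm j s → v ∈ sweepMove K j s
        next∈ s v∈ = ∈-++⁺ʳ (pathNode j s) (∈-++⁺ˡ v∈)
        later-first∈ : ∀ s i jj → j < toℕ i → toℕ jj ≡ 0 → path i jj ∈ sweepMove K j s
        later-first∈ s i jj j<i jj≡0 =
          ∈-++⁺ʳ (pathNode j s) (∈-++⁺ʳ (nextOnArm j s) (∈-++⁺ˡ (∈-firstNodesFrom j<i jj≡0)))
        swept-attachment∈ : ∀ s i → K ≤ toℕ i → toℕ i < j → hv i (u i) ∈ sweepMove K j s
        swept-attachment∈ s i K≤i i<j =
          ∈-++⁺ʳ (pathNode j s) (∈-++⁺ʳ (nextOnArm j s) (∈-++⁺ʳ (firstNodesFrom (suc j))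
            (∈-concatRange attachment K j K≤i i<j (∈-attachment refl))))

      front-shielded : ∀ s → s < β → ∀ i jj → toℕ i ≡ j → toℕ jj ≤ s → Shielded (Sweeping K j s) (sweepMove K j s) (path i jj)
      front-shielded s s<β i jj i≡j jj≤s = self , nbrs
        where
        self : Sweeping K j s (path i jj) → path i jj ∈ sweepMove K j s
        self (inj₁ j<i)        = ⊥-elim (<-irrefl (sym i≡j) j<i)
        self (inj₂ (_ , s≤jj)) = current∈ s i jj i≡j (≤-antisym jj≤s s≤jj)
        nbrs : ∀ w → Adj G w (path i jj) → Sweeping K j s w → w ∈ sweepMove K j s
        nbrs _ (inj₁ (e-cpath _)) ()
        nbrs _ (inj₁ (e-path _)) (inj₁ j<i) = ⊥-elim (<-irrefl (sym i≡j) j<i)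
        nbrs _ (inj₁ (e-path jj≡1+j₀)) (inj₂ (_ , s≤j₀)) =
          ⊥-elim (<-irrefl refl (≤-trans (≤-reflexive (sym jj≡1+j₀)) (≤-trans jj≤s s≤j₀)))
        nbrs _ (inj₂ (e-path _)) (inj₁ j<i) = ⊥-elim (<-irrefl (sym i≡j) j<i)
        nbrs (path _ j₁) (inj₂ (e-path j₁≡1+jj)) (inj₂ (_ , s≤j₁)) with m≤n⇒m<n∨m≡n s≤j₁
        ... | inj₂ s≡j₁ = current∈ s i j₁ i≡j (sym s≡j₁)
        ... | inj₁ s<j₁ = next∈ s (∈-nextOnArm-path i≡j (≤-antisym (≤-trans (≤-reflexive j₁≡1+jj) (s≤s jj≤s)) s<j₁))
        nbrs _ (inj₂ (e-pathH 1+jj≡β)) _ =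
          next∈ s (∈-nextOnArm-attachment i≡j
            (trans (cong suc (≤-antisym (≤-pred (≤-trans s<β (≤-reflexive (sym 1+jj≡β)))) jj≤s)) 1+jj≡β))

      swept-shielded : ∀ s i jj → toℕ i < j → Shielded (Sweeping K j s) (sweepMove K j s) (path i jj)
      swept-shielded s i jj i<j = self , nbrs
        where
        self : Sweeping K j s (path i jj) → path i jj ∈ sweepMove K j s
        self (inj₁ j<i)       = ⊥-elim (<-asym i<j j<i)
        self (inj₂ (i≡j , _)) = ⊥-elim (<-irrefl i≡j i<j)
        nbrs : ∀ w → Adj G w (path i jj) → Sweeping K j s w → w ∈ sweepMove K j s
        nbrs _ (inj₁ (e-cpath _)) ()
        nbrs _ (inj₁ (e-path _)) (inj₁ j<i)       = ⊥-elim (<-asym i<j j<i)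
        nbrs _ (inj₁ (e-path _)) (inj₂ (i≡j , _)) = ⊥-elim (<-irrefl i≡j i<j)
        nbrs _ (inj₂ (e-path _)) (inj₁ j<i)       = ⊥-elim (<-asym i<j j<i)
        nbrs _ (inj₂ (e-path _)) (inj₂ (i≡j , _)) = ⊥-elim (<-irrefl i≡j i<j)
        nbrs _ (inj₂ (e-pathH _)) K≤i             = swept-attachment∈ s i K≤i i<j

      sweep-step : ∀ s → s < β → step G (Sweeping K j s) (sweepMove K j s) ⊆ Sweeping K j (suc s)
      sweep-step s s<β {old _} (inj₁ (() , _))
      sweep-step s s<β {old _} (inj₂ (_ , inj₁ (e-X _) , () , _))
      sweep-step s s<β {old _} (inj₂ (_ , inj₂ (e-X _) , () , _))
      sweep-step s s<β {old _} (inj₂ (_ , inj₁ e-cX , () , _))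
      sweep-step s s<β {c} (inj₁ (() , _))
      sweep-step s s<β {c} (inj₂ (_ , inj₂ e-cX , () , _))
      sweep-step s s<β {c} (inj₂ (path i jj , inj₂ (e-cpath jj≡0) , inj₁ j<i , w∉F)) =
        w∉F (later-first∈ s i jj j<i jj≡0)
      sweep-step s s<β {c} (inj₂ (path i jj , inj₂ (e-cpath jj≡0) , inj₂ (i≡j , s≤jj) , w∉F)) =
        w∉F (current∈ s i jj i≡j (trans jj≡0 (sym (n≤0⇒n≡0 (≤-trans s≤jj (≤-reflexive jj≡0))))))
      sweep-step s s<β {path i jj} burns with j <? toℕ i
      ... | yes j<i = inj₁ j<i
      ... | no j≮i with toℕ i ≟ j
      ...   | no i≢j = ⊥-elim (shielded (swept-shielded s i jj (≤∧≢⇒< (≮⇒≥ j≮i) i≢j)) burns)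
      ...   | yes i≡j with suc s ≤? toℕ jj
      ...     | yes s<jj = inj₂ (i≡j , s<jj)
      ...     | no s≮jj  = ⊥-elim (shielded (front-shielded s s<β i jj i≡j (≤-pred (≰⇒> s≮jj))) burns)
      sweep-step s s<β {hv _ _} burns = ≮⇒≥ (lower-arms-stay-clean (sweeping-confined K≤j) (λ ()) burns)
      sweep-step s s<β {hw _ _} burns = ≮⇒≥ (lower-arms-stay-clean (sweeping-confined K≤j) (λ ()) burns)

    sweep-arms : ∀ K → 1 ≤ K → K < m → Plan (Sweeping K K 0) (Sweeping K m 0)
    sweep-arms K 1≤K K<m = iterate (λ j → Sweeping K j 0) (<⇒≤ K<m) (λ j K≤j j<m → sweep-arm j K≤j j<m)
      where
      next-arm : ∀ j → Sweeping K j β ⊆ Sweeping K (suc j) 0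
      next-arm j {path i _}  (inj₁ j<i) with m≤n⇒m<n∨m≡n j<i
      ... | inj₁ j+1<i = inj₁ j+1<i
      ... | inj₂ j+1≡i = inj₂ (sym j+1≡i , z≤n)
      next-arm j {path _ jj} (inj₂ (_ , β≤jj)) = ⊥-elim (<⇒≱ (toℕ<n jj) β≤jj)
      next-arm j {hv _ _} K≤i = K≤i
      next-arm j {hw _ _} K≤i = K≤i

      sweep-arm : ∀ j → K ≤ j → j < m → Plan (Sweeping K j 0) (Sweeping K (suc j) 0)
      sweep-arm j K≤j j<m =
        iterate (Sweeping K j) z≤n
          (λ s _ s<β → protect (sweepMove K j s) (length-sweepMove K j s 1≤K K≤j j<m) (SweepArm.sweep-step K j K≤j s s<β)) ⨾
        relax (next-arm j)

    -- While gadget K is cleared, fire from the gadgets beyond K walks back along their arms: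
    -- it reaches the centre after β + 1 rounds, X and the first nodes of all arms after β + 2,
    -- the node j of an arm after β + 2 + j and an earlier gadget only after 2β + 2 ≥ α rounds.
    Leaking : ℕ → ℕ → Region
    Leaking K t (old x)    = suc K < m × 2 + β ≤ t
    Leaking K t c          = suc K < m × suc β ≤ t
    Leaking K t (path i j) = (K < toℕ i × β ≤ t + toℕ j) ⊎ (suc K < m × 2 + β + toℕ j ≤ t)
    Leaking K t (hv i a)   = K < toℕ i
                           ⊎ (toℕ i ≡ K × (t < α ⊎ (suc K < m × a ≡ u i)))
                           ⊎ (toℕ i < K × suc K < m × a ≡ u i × 2 + β + β ≤ t)
    Leaking K t (hw i b)   = K < toℕ i ⊎ (toℕ i ≡ K × t ≤ toℕ b)

    α≤2+β+β : α ≤ 2 + β + β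
    α≤2+β+β = ≤-trans α≤2β+2 (≤-reflexive (trans (+-comm (2 * β) 2) (cong (λ n → 2 + (β + n)) (+-identityʳ β))))

    later-gadget⇒1+K<m : ∀ {K} (i : Fin m) → K < toℕ i → suc K < m
    later-gadget⇒1+K<m i K<i = ≤-trans (s≤s K<i) (toℕ<n i)

    module LeakArithmetic {t : ℕ} where
      centre-lit-from-late : ∀ {j} → β ≤ t + j → j ≡ 0 → suc β ≤ suc t
      centre-lit-from-late le refl = s≤s (≤-trans le (≤-reflexive (+-identityʳ t)))
      centre-lit-from-far : ∀ {j} → 2 + β + j ≤ t → j ≡ 0 → suc β ≤ suc t
      centre-lit-from-far le refl = m≤n⇒m≤1+n (≤-trans (s≤s (≤-trans (m≤m+n β 0) (n≤1+n (β + 0)))) le)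
      far-lit-from-centre : ∀ {j} → suc β ≤ t → j ≡ 0 → 2 + β + j ≤ suc t
      far-lit-from-centre le refl = s≤s (≤-trans (≤-reflexive (cong suc (+-identityʳ β))) le)
      late-lit-from-previous : ∀ {j j₀} → β ≤ t + j₀ → j ≡ suc j₀ → β ≤ suc t + j
      late-lit-from-previous le refl = ≤-trans le (+-mono-≤ (n≤1+n t) (n≤1+n _))
      far-lit-from-previous : ∀ {j j₀} → 2 + β + j₀ ≤ t → j ≡ suc j₀ → 2 + β + j ≤ suc t
      far-lit-from-previous {j₀ = j₀} le refl = s≤s (≤-trans (≤-reflexive (cong suc (+-suc β j₀))) le)
      late-lit-from-next : ∀ {j j₁} → β ≤ t + j₁ → j₁ ≡ suc j → β ≤ suc t + j
      late-lit-from-next {j} le refl = ≤-trans le (≤-reflexive (+-suc t j))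
      far-lit-from-next : ∀ {j j₁} → 2 + β + j₁ ≤ t → j₁ ≡ suc j → 2 + β + j ≤ suc t
      far-lit-from-next {j} le refl = m≤n⇒m≤1+n (≤-trans (s≤s (s≤s (+-monoʳ-≤ β (n≤1+n j)))) le)
      late-lit-from-gadget : ∀ {j} → suc j ≡ β → β ≤ suc t + j
      late-lit-from-gadget {j} refl = s≤s (m≤n+m j t)
      attachment-lit-from-far : ∀ {j} → 2 + β + j ≤ t → suc j ≡ β → 2 + β + β ≤ suc t
      attachment-lit-from-far {j} le 1+j≡β =
        s≤s (≤-trans (≤-reflexive (cong suc (trans (cong (β +_) (sym 1+j≡β)) (+-suc β j)))) le)

    module LeakRound (K t : ℕ) (t<α : t < α) where
      open LeakArithmetic {t}

      leaves-scheduled : ∀ {i b} → toℕ i ≡ K → Leaking K t (hw i b) → t ≤ toℕ b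
      leaves-scheduled i≡K (inj₁ K<i)      = ⊥-elim (<-irrefl (sym i≡K) K<i)
      leaves-scheduled i≡K (inj₂ (_ , t≤b)) = t≤b

      open GadgetClearing {K} {t} {Leaking K t} leaves-scheduled

      not-yet-back : ¬ (2 + β + β ≤ t)
      not-yet-back le = <-irrefl refl (≤-trans t<α (≤-trans α≤2+β+β le))

      earlier-clique-clean : ∀ {i a} → toℕ i < K → ¬ Leaking K t (hv i a)
      earlier-clique-clean i<K (inj₁ K<i)                       = <-asym i<K K<i
      earlier-clique-clean i<K (inj₂ (inj₁ (i≡K , _)))          = <-irrefl i≡K i<K
      earlier-clique-clean i<K (inj₂ (inj₂ (_ , _ , _ , back))) = not-yet-back back

      earlier-leaf-clean : ∀ {i b} → toℕ i < K → ¬ Leaking K t (hw i b)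
      earlier-leaf-clean i<K (inj₁ K<i)       = <-asym i<K K<i
      earlier-leaf-clean i<K (inj₂ (i≡K , _)) = <-irrefl i≡K i<K

      F : List Node
      F = gadgetMove K t

      leak-X : ∀ {x} → step G (Leaking K t) F (old x) → Leaking K (suc t) (old x)
      leak-X (inj₁ ((1+K<m , le) , _))                    = 1+K<m , m≤n⇒m≤1+n le
      leak-X (inj₂ (_ , inj₁ (e-X _) , (1+K<m , le) , _)) = 1+K<m , m≤n⇒m≤1+n le
      leak-X (inj₂ (_ , inj₂ (e-X _) , (1+K<m , le) , _)) = 1+K<m , m≤n⇒m≤1+n le
      leak-X (inj₂ (_ , inj₁ e-cX , (1+K<m , le) , _))    = 1+K<m , s≤s le

      leak-centre : step G (Leaking K t) F c → Leaking K (suc t) c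
      leak-centre (inj₁ ((1+K<m , le) , _))                 = 1+K<m , m≤n⇒m≤1+n le
      leak-centre (inj₂ (_ , inj₂ e-cX , (1+K<m , le) , _)) = 1+K<m , m≤n⇒m≤1+n (≤-trans (n≤1+n _) le)
      leak-centre (inj₂ (path i j , inj₂ (e-cpath j≡0) , inj₁ (K<i , le) , _)) =
        later-gadget⇒1+K<m i K<i , centre-lit-from-late le j≡0
      leak-centre (inj₂ (path i j , inj₂ (e-cpath j≡0) , inj₂ (1+K<m , le) , _)) =
        1+K<m , centre-lit-from-far le j≡0

      leak-path : ∀ {i j} → step G (Leaking K t) F (path i j) → Leaking K (suc t) (path i j)
      leak-path (inj₁ (inj₁ (K<i , le) , _))    = inj₁ (K<i , m≤n⇒m≤1+n le)
      leak-path (inj₁ (inj₂ (1+K<m , le) , _)) = inj₂ (1+K<m , m≤n⇒m≤1+n le)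
      leak-path (inj₂ (_ , inj₁ (e-cpath j≡0) , (1+K<m , le) , _)) = inj₂ (1+K<m , far-lit-from-centre le j≡0)
      leak-path (inj₂ (_ , inj₁ (e-path eq) , inj₁ (K<i , le) , _))  = inj₁ (K<i , late-lit-from-previous le eq)
      leak-path (inj₂ (_ , inj₁ (e-path eq) , inj₂ (1+K<m , le) , _)) = inj₂ (1+K<m , far-lit-from-previous le eq)
      leak-path (inj₂ (_ , inj₂ (e-path eq) , inj₁ (K<i , le) , _))  = inj₁ (K<i , late-lit-from-next le eq)
      leak-path (inj₂ (_ , inj₂ (e-path eq) , inj₂ (1+K<m , le) , _)) = inj₂ (1+K<m , far-lit-from-next le eq)
      leak-path (inj₂ (_ , inj₂ (e-pathH eq) , inj₁ K<i , _)) = inj₁ (K<i , late-lit-from-gadget eq)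
      leak-path {i} (inj₂ (_ , inj₂ (e-pathH _) , inj₂ (inj₁ (i≡K , _)) , u∉F)) =
        ⊥-elim (u∉F (∈-++⁺ʳ (leafNode K t) (∈-cliqueOf i≡K)))
      leak-path (inj₂ (_ , inj₂ (e-pathH _) , inj₂ (inj₂ (_ , _ , _ , back)) , _)) = ⊥-elim (not-yet-back back)

      leak-clique : ∀ {i a} → step G (Leaking K t) F (hv i a) → Leaking K (suc t) (hv i a)
      leak-clique {i} {a} burns with <-cmp (toℕ i) K
      ... | tri> _ _ K<i = inj₁ K<i
      ... | tri≈ _ i≡K _ = current-gadget
        where
        current-gadget : Leaking K (suc t) (hv i a)
        current-gadget with suc t <? α
        ... | yes 1+t<α = inj₂ (inj₁ (i≡K , inj₁ 1+t<α))
        ... | no 1+t≮α with a Fin.≟ u i | suc K <? m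
        ...   | yes a≡u | yes 1+K<m = inj₂ (inj₁ (i≡K , inj₂ (1+K<m , a≡u)))
        ...   | yes _   | no 1+K≮m  = ⊥-elim (shielded (clique-shielded i≡K (≤-antisym t<α (≮⇒≥ 1+t≮α)) no-far-fire) burns)
          where
          no-far-fire : a ≡ u i → ∀ j → ¬ Leaking K t (path i j)
          no-far-fire _ _ (inj₁ (K<i , _))    = <-irrefl (sym i≡K) K<i
          no-far-fire _ _ (inj₂ (1+K<m , _)) = 1+K≮m 1+K<m
        ...   | no a≢u  | _         = ⊥-elim (shielded (clique-shielded i≡K (≤-antisym t<α (≮⇒≥ 1+t≮α)) (λ a≡u → ⊥-elim (a≢u a≡u))) burns)
      ... | tri< i<K _ _ = lit-from-own-arm burns
        where
        lit-from-own-arm : step G (Leaking K t) F (hv i a) → Leaking K (suc t) (hv i a)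
        lit-from-own-arm (inj₁ (d , _)) = ⊥-elim (earlier-clique-clean i<K d)
        lit-from-own-arm (inj₂ (_ , inj₁ (e-pathH _) , inj₁ (K<i , _) , _)) = ⊥-elim (<-asym i<K K<i)
        lit-from-own-arm (inj₂ (_ , inj₁ (e-pathH 1+j≡β) , inj₂ (1+K<m , le) , _)) =
          inj₂ (inj₂ (i<K , 1+K<m , refl , attachment-lit-from-far le 1+j≡β))
        lit-from-own-arm (inj₂ (_ , inj₁ (e-clique _) , d , _)) = ⊥-elim (earlier-clique-clean i<K d)
        lit-from-own-arm (inj₂ (_ , inj₂ (e-clique _) , d , _)) = ⊥-elim (earlier-clique-clean i<K d)
        lit-from-own-arm (inj₂ (_ , inj₂ e-H , d , _))          = ⊥-elim (earlier-leaf-clean i<K d)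

      leak-leaf : ∀ {i b} → step G (Leaking K t) F (hw i b) → Leaking K (suc t) (hw i b)
      leak-leaf {i} {b} burns with <-cmp (toℕ i) K
      ... | tri> _ _ K<i = inj₁ K<i
      ... | tri≈ _ i≡K _ with suc t ≤? toℕ b
      ...   | yes t<b = inj₂ (i≡K , t<b)
      ...   | no t≮b  = ⊥-elim (shielded (leaf-shielded i≡K t≮b) burns)
      leak-leaf {i} {b} (inj₁ (d , _))           | tri< i<K _ _ = ⊥-elim (earlier-leaf-clean i<K d)
      leak-leaf {i} {b} (inj₂ (_ , inj₁ e-H , d , _)) | tri< i<K _ _ = ⊥-elim (earlier-clique-clean i<K d)

      leak-step : step G (Leaking K t) F ⊆ Leaking K (suc t)
      leak-step {old _}    = leak-X
      leak-step {c}        = leak-centre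
      leak-step {path _ _} = leak-path
      leak-step {hv _ _}   = leak-clique
      leak-step {hw _ _}   = leak-leaf

    clear-gadget : ∀ K → Plan (Sweeping K m 0) (ClearedBelow (suc K))
    clear-gadget K =
      relax start ⨾
      iterate (Leaking K) z≤n (λ t _ t<α → protect (gadgetMove K t) (length-gadgetMove K t) (LeakRound.leak-step K t t<α)) ⨾
      relax finish
      where
      start : Sweeping K m 0 ⊆ Leaking K 0
      start {path i _} (inj₁ m<i)       = ⊥-elim (<-asym m<i (toℕ<n i))
      start {path i _} (inj₂ (i≡m , _)) = ⊥-elim (<-irrefl i≡m (toℕ<n i))
      start {hv i _} K≤i with m≤n⇒m<n∨m≡n K≤i
      ... | inj₁ K<i = inj₁ K<i
      ... | inj₂ K≡i = inj₂ (inj₁ (sym K≡i , inj₁ 1≤α))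
      start {hw i _} K≤i with m≤n⇒m<n∨m≡n K≤i
      ... | inj₁ K<i = inj₁ K<i
      ... | inj₂ K≡i = inj₂ (sym K≡i , z≤n)

      finish : Leaking K α ⊆ ClearedBelow (suc K)
      finish {old _}    (1+K<m , _)                          = 1+K<m , tt
      finish {c}        (1+K<m , _)                          = 1+K<m , tt
      finish {path i _} (inj₁ (K<i , _))                     = later-gadget⇒1+K<m i K<i , tt
      finish {path _ _} (inj₂ (1+K<m , _))                   = 1+K<m , tt
      finish {hv i _}   (inj₁ K<i)                           = later-gadget⇒1+K<m i K<i , inj₁ K<i
      finish {hv _ _}   (inj₂ (inj₁ (_ , inj₁ α<α)))         = ⊥-elim (<-irrefl refl α<α)
      finish {hv _ _}   (inj₂ (inj₁ (_ , inj₂ (1+K<m , a≡u)))) = 1+K<m , inj₂ a≡u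
      finish {hv _ _}   (inj₂ (inj₂ (_ , 1+K<m , a≡u , _)))  = 1+K<m , inj₂ a≡u
      finish {hw i _}   (inj₁ K<i)                           = later-gadget⇒1+K<m i K<i , K<i
      finish {hw _ b}   (inj₂ (_ , α≤b))                     = ⊥-elim (<⇒≱ (toℕ<n b) α≤b)

    module _ {SX : List (List (V X))} (SX-wins : WinningStrategy X (m ∸ 1) SX) where

      round : ∀ K → 1 ≤ K → K < m → Plan (ClearedBelow K) (ClearedBelow (suc K))
      round K 1≤K K<m =
        restore K K<m ⨾
        relax (enter-xphase K) ⨾
        play-X K SX (proj₁ SX-wins) ⨾
        protect (clearCentreMove K) (length-clearCentreMove K 1≤K) (clear-centre-step K (proj₂ SX-wins)) ⨾
        sweep-arms K 1≤K K<m ⨾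
        clear-gadget K

      extinguish : Plan U ∅
      extinguish =
        clear-first-gadget ⨾
        iterate ClearedBelow 1≤m round ⨾
        relax (λ { (m<m , _) → <-irrefl refl m<m })

  below-m-loses : Fin m → Fin α → ∀ k → Winnable G k → m ≤ k
  below-m-loses i b k k-wins with m ≤? k
  ... | yes m≤k = m≤k
  ... | no m≰k  = ⊥-elim (gadget-survives i b k (≰⇒> m≰k) k-wins)

-- The lower bound comes from the gadgets alone.
lemma4 : (α β : ℕ) → 1 ≤ α → 1 ≤ β → α ≤ 2 * β + 2 → β + 3 ≤ α →
         (m : ℕ) → 2 ≤ m → (X : Graph) → Finite X → IsFFN X (m ∸ 1) →
         (u : Fin m → Fin (m ∸ 1)) → IsFFN (Gm α β m X u) m
lemma4 α β 1≤α _ α≤2β+2 _ m 2≤m X _ (_ , (SX , SX-wins) , _) u =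
  ≤-trans (s≤s z≤n) 2≤m ,
  Plans.winnable (Gm α β m X u) m (Strategy.extinguish 1≤α α≤2β+2 2≤m SX-wins) ,
  λ k _ → below-m-loses (fromℕ< 2≤m) (fromℕ< 1≤α) k
  where open Construction α β m X u
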